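{- Let a GCR game family be given and let $T^0,T^1,\dots$ be the labels produced by the vertex labeling algorithm, with $\overline{T}(s)=\lim_{i\to\infty}T^i(s)$ and $\widetilde{T}(s)=\min\{i: T^i(s)<\infty\}$ (with $\min\emptyset=\infty$). Then for every $s\in\overline{S}$, $\overline{T}(s)=\widetilde{T}(s)$.
   Context: A GCR game family consists of: finite location sets $V^1,V^2$; the set of nonterminal states $\overline{S}=V^1\times V^2\times\{1,2\}$, where in state $(x^1,x^2,n)$ player $P^n$ has the move ($P^1$ is the Pursuer, $P^2$ the Evader); $S^n=\{(x^1,x^2,n)\}$ for $n\in\{1,2\}$; a set of capture states $S_c\subseteq\overline{S}$, with $S_{nc}=\overline{S}\setminus S_c$; for each $s\in S_{nc}$ a nonempty set $N(s)\subseteq\overline{S}$ of possible next states. Players need not alternate. Vertex labeling algorithm: for $s\in\overline{S}$ set $T^0(s)=0$ if $s\in S_c$ and $T^0(s)=\infty$ otherwise. For $i=1,2,\dots$ and each $s\in\overline{S}$: if $T^{i-1}(s)<\infty$ set $T^i(s)=T^{i-1}(s)$; otherwise, if $s\in S^1$ set $T^i(s)=1+\min_{s'\in N(s)}T^{i-1}(s')$, and if $s\in S^2$ set $T^i(s)=1+\max_{s'\in N(s)}T^{i-1}(s')$ (with $1+\infty=\infty$). For each $s$ the sequence $(T^i(s))_i$ is eventually constant, so the limit exists in $\mathbb{N}_0\cup\{\infty\}$. -}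

module Defs where

open import Data.Nat using (ℕ; zero; suc; _<_; _≤_) renaming (_⊔_ to _⊔ℕ_; _⊓_ to _⊓ℕ_)
open import Data.Fin using (Fin)
open import Data.Bool using (Bool; true; false; if_then_else_)
open import Data.List using (List; []; _∷_; filter; foldr; map; cartesianProduct; allFin)
open import Data.Product using (_×_; _,_; Σ; ∃)
open import Relation.Binary.PropositionalEquality using (_≡_)
open import Data.Bool using (_≟_)

data ℕ∞ : Set where
  fin : ℕ → ℕ∞
  ∞   : ℕ∞

suc∞ : ℕ∞ → ℕ∞
suc∞ (fin n) = fin (suc n)
suc∞ ∞       = ∞

min∞ : ℕ∞ → ℕ∞ → ℕ∞
min∞ (fin a) (fin b) = fin (a ⊓ℕ b)
min∞ (fin a) ∞       = fin a
min∞ ∞       y       = y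

max∞ : ℕ∞ → ℕ∞ → ℕ∞
max∞ (fin a) (fin b) = fin (a ⊔ℕ b)
max∞ (fin a) ∞       = ∞
max∞ ∞       y       = ∞

-- minimum / maximum of a list; only ever applied to nonempty lists
-- (the empty conventions are irrelevant for the algorithm)
minL : List ℕ∞ → ℕ∞
minL = foldr min∞ ∞

maxL : List ℕ∞ → ℕ∞
maxL []       = ∞
maxL (x ∷ xs) = foldr max∞ x xs

-- Players: P₁ = Pursuer, P₂ = Evader
data Player : Set where
  P₁ P₂ : Player

-- Nonterminal states S̄ = V¹ × V² × {1,2}, with V¹ = Fin m, V² = Fin k
State : ℕ → ℕ → Set
State m k = Fin m × Fin k × Player

allPlayers : List Player
allPlayers = P₁ ∷ P₂ ∷ []

allStates : (m k : ℕ) → List (State m k)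
allStates m k = cartesianProduct (allFin m) (cartesianProduct (allFin k) allPlayers)

-- A GCR game family on locations V¹ = Fin m, V² = Fin k.
-- The capture set S_c and the next-state relation N are given as
-- Boolean-valued (i.e. decidable) predicates on the finite set of states.
record GCR (m k : ℕ) : Set where
  field
    capture  : State m k → Bool
    next     : State m k → State m k → Bool
    next-nonempty : (s : State m k) → capture s ≡ false →
                    Σ (State m k) (λ s' → next s s' ≡ true)

module _ {m k : ℕ} (G : GCR m k) where
  open GCR G

  N : State m k → List (State m k)
  N s = filter (λ s' → next s s' ≟ true) (allStates m k)

  playerOf : State m k → Player
  playerOf (_ , _ , n) = n

  T : ℕ → State m k → ℕ∞
  T zero s = if capture s then fin 0 else ∞
  T (suc i) s with T i s
  ... | fin t = fin t
  ... | ∞ with playerOf s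
  ...   | P₁ = suc∞ (minL (map (T i) (N s)))
  ...   | P₂ = suc∞ (maxL (map (T i) (N s)))

  IsLimit : State m k → ℕ∞ → Set
  IsLimit s v = ∃ λ i₀ → ∀ i → i₀ ≤ i → T i s ≡ v

  IsFirstFinite : State m k → ℕ∞ → Set
  IsFirstFinite s (fin n) = (∃ λ t → T n s ≡ fin t) × (∀ j → j < n → T j s ≡ ∞)
  IsFirstFinite s ∞       = ∀ j → T j s ≡ ∞

module Submission where

-- Whenever T^i(s) = t is finite, then t ≤ i,
--     T^t(s) = t and T^j(s) = ∞ for all j < t: a finite label records the
--     step at which the state received it.  By induction on i: a state that
--     is labelled at step i+1 gets 1 + u, where u is the optimal label among
--     its successors; u is attained by some successor, so u ≤ i, and if u < i
--     the same optimum would already have been finite at step u (for P¹ the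
--     attaining successor, for P² every successor, is labelled by step u),
--     so s would have been labelled before step i.
--
-- Finite labels are never changed, so the set of labelled
--     states grows monotonically inside a finite set and must stop growing;
--     one round without new labels is a fixed point of the relabelling step,
--     hence every later label equals the current one.
--
-- For a state labelled at the fixed point, (1) identifies the limit with the
-- entry time; an unlabelled state stays ∞ forever, and so does T̃.

open import Defs
open import Data.Nat using (ℕ)
open import Data.Product using (_×_; ∃)

open import Data.Nat using (zero; suc; _≤_; _<_; _≤′_; ≤′-refl; ≤′-step; z≤n; s≤s; _<?_; _≤?_; _⊔_; _⊓_)
open import Data.Nat.Properties
  using (≤-refl; ≤-trans; ≤-antisym; ≤-total; ≤-pred; <-irrefl; ≮⇒≥; ≤-reflexive;
         ≤⇒≤′; ≰⇒>; m≤n⇒m≤1+n; ⊓-sel; ⊔-sel; m≤m⊔n; m≤n⊔m)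
open import Data.Bool using (Bool; true; false; if_then_else_) renaming (T to IsTrue)
open import Data.Unit using (tt)
open import Data.List using (List; []; _∷_; map; length)
open import Data.List.Properties using (map-cong)
open import Data.List.Membership.Propositional using (_∈_)
open import Data.List.Membership.Propositional.Properties using (∈-cartesianProduct⁺; ∈-allFin)
open import Data.List.Relation.Unary.All as All using (All; []; _∷_)
open import Data.List.Relation.Unary.Any as Any using (Any; here; there)
import Data.List.Relation.Unary.All.Properties as AllP
import Data.List.Relation.Unary.Any.Properties as AnyP
open import Data.Product using (_,_; proj₁; proj₂)
open import Data.Sum using (_⊎_; inj₁; inj₂)
open import Data.Empty using (⊥-elim)
open import Function using (_∘_)
open import Relation.Nullary using (yes; no; ¬_)
open import Relation.Binary.PropositionalEquality using (_≡_; refl; sym; trans; cong; cong₂; subst; _≗_; module ≡-Reasoning)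

IsFin : ℕ∞ → Set
IsFin x = ∃ λ v → x ≡ fin v

AtMost : ℕ → ℕ∞ → Set
AtMost u x = ∃ λ v → x ≡ fin v × v ≤ u

isFin : ℕ∞ → Bool
isFin (fin _) = true
isFin ∞       = false

fin≢∞ : ∀ {t} → ¬ fin t ≡ ∞
fin≢∞ ()

fin-injective : ∀ {a b} → fin a ≡ fin b → a ≡ b
fin-injective refl = refl

suc∞-fin : ∀ x {t} → suc∞ x ≡ fin t → ∃ λ u → x ≡ fin u × t ≡ suc u
suc∞-fin (fin u) refl = u , refl , refl

min∞-attained : ∀ x y {u} → min∞ x y ≡ fin u → x ≡ fin u ⊎ y ≡ fin u
min∞-attained (fin a) (fin b) eq with ⊓-sel a b
... | inj₁ a⊓b≡a = inj₁ (trans (cong fin (sym a⊓b≡a)) eq)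
... | inj₂ a⊓b≡b = inj₂ (trans (cong fin (sym a⊓b≡b)) eq)
min∞-attained (fin a) ∞ eq = inj₁ eq
min∞-attained ∞       y eq = inj₂ eq

min∞-finiteˡ : ∀ {x} y → IsFin x → IsFin (min∞ x y)
min∞-finiteˡ (fin b) (a , refl) = a ⊓ b , refl
min∞-finiteˡ ∞       (a , refl) = a , refl

min∞-finiteʳ : ∀ x {y} → IsFin y → IsFin (min∞ x y)
min∞-finiteʳ (fin a) (b , refl) = a ⊓ b , refl
min∞-finiteʳ ∞       finite-y   = finite-y

max∞-attained : ∀ x y {u} → max∞ x y ≡ fin u → x ≡ fin u ⊎ y ≡ fin u
max∞-attained (fin a) (fin b) eq with ⊔-sel a b
... | inj₁ a⊔b≡a = inj₁ (trans (cong fin (sym a⊔b≡a)) eq)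
... | inj₂ a⊔b≡b = inj₂ (trans (cong fin (sym a⊔b≡b)) eq)

max∞-bounded : ∀ x y {u} → max∞ x y ≡ fin u → AtMost u x × AtMost u y
max∞-bounded (fin a) (fin b) eq =
  (a , refl , ≤-trans (m≤m⊔n a b) (≤-reflexive (fin-injective eq))) ,
  (b , refl , ≤-trans (m≤n⊔m a b) (≤-reflexive (fin-injective eq)))

max∞-finite : ∀ {x y} → IsFin x → IsFin y → IsFin (max∞ x y)
max∞-finite (a , refl) (b , refl) = a ⊔ b , refl

-- The same facts for minL and for maxL of a nonempty list; note that
-- maxL (x ∷ y ∷ ys) reduces to max∞ y (maxL (x ∷ ys)).

minL-attained : ∀ xs {u} → minL xs ≡ fin u → Any (_≡ fin u) xs
minL-attained (x ∷ xs) eq with min∞-attained x (minL xs) eq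
... | inj₁ x≡u    = here x≡u
... | inj₂ rest≡u = there (minL-attained xs rest≡u)

minL-finite : ∀ {xs} → Any IsFin xs → IsFin (minL xs)
minL-finite {x ∷ xs} (here finite-x) = min∞-finiteˡ (minL xs) finite-x
minL-finite {x ∷ xs} (there finite)  = min∞-finiteʳ x (minL-finite finite)

maxL-attained : ∀ x xs {u} → maxL (x ∷ xs) ≡ fin u → Any (_≡ fin u) (x ∷ xs)
maxL-attained x []       eq = here eq
maxL-attained x (y ∷ ys) eq with max∞-attained y (maxL (x ∷ ys)) eq
... | inj₁ y≡u    = there (here y≡u)
... | inj₂ rest≡u with maxL-attained x ys rest≡u
...   | here x≡u      = here x≡u
...   | there ys-hit  = there (there ys-hit)

maxL-bounded : ∀ x xs {u} → maxL (x ∷ xs) ≡ fin u → All (AtMost u) (x ∷ xs)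
maxL-bounded x []       eq = (_ , eq , ≤-refl) ∷ []
maxL-bounded x (y ∷ ys) eq with max∞-bounded y (maxL (x ∷ ys)) eq
... | y≤u , (w , rest≡w , w≤u) with maxL-bounded x ys rest≡w
...   | x≤w ∷ ys≤w = weaken x≤w ∷ y≤u ∷ All.map weaken ys≤w
  where
  weaken : ∀ {z} → AtMost w z → AtMost _ z
  weaken (v , z≡v , v≤w) = v , z≡v , ≤-trans v≤w w≤u

maxL-finite : ∀ x xs → All IsFin (x ∷ xs) → IsFin (maxL (x ∷ xs))
maxL-finite x []       (finite-x ∷ [])          = finite-x
maxL-finite x (y ∷ ys) (finite-x ∷ finite-y ∷ rest) =
  max∞-finite finite-y (maxL-finite x ys (finite-x ∷ rest))

optimum : Player → List ℕ∞ → ℕ∞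
optimum P₁ = minL
optimum P₂ = maxL

optimum-attained : ∀ pl xs {u} → optimum pl xs ≡ fin u → Any (_≡ fin u) xs
optimum-attained P₁ xs       eq = minL-attained xs eq
optimum-attained P₂ (x ∷ xs) eq = maxL-attained x xs eq

-- For P¹ only the attaining element matters;
-- for P² every element has f-value at most u.
optimum-transfer : ∀ {A : Set} pl (as : List A) (f g : A → ℕ∞) {u} →
  optimum pl (map f as) ≡ fin u → (∀ a → AtMost u (f a) → IsFin (g a)) →
  IsFin (optimum pl (map g as))
optimum-transfer P₁ as f g eq transfer =
  minL-finite (AnyP.map⁺ (Any.map (λ {a} fa≡u → transfer a (_ , fa≡u , ≤-refl))
                                  (AnyP.map⁻ (minL-attained (map f as) eq))))
optimum-transfer P₂ (a ∷ as) f g eq transfer =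
  maxL-finite (g a) (map g as)
    (AllP.map⁺ (All.map (λ {b} → transfer b) (AllP.map⁻ (maxL-bounded (f a) (map f as) eq))))

countTrue : {A : Set} → (A → Bool) → List A → ℕ
countTrue q []       = 0
countTrue q (x ∷ xs) = if q x then suc (countTrue q xs) else countTrue q xs

countTrue≤length : {A : Set} (q : A → Bool) (xs : List A) → countTrue q xs ≤ length xs
countTrue≤length q []       = z≤n
countTrue≤length q (x ∷ xs) with q x
... | true  = s≤s (countTrue≤length q xs)
... | false = m≤n⇒m≤1+n (countTrue≤length q xs)

countTrue-mono : {A : Set} (q r : A → Bool) → (∀ x → IsTrue (q x) → IsTrue (r x)) →
  (xs : List A) → countTrue q xs ≤ countTrue r xs
countTrue-mono q r q⇒r []       = z≤n
countTrue-mono q r q⇒r (x ∷ xs) with q x | r x | q⇒r x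
... | true  | true  | _   = s≤s (countTrue-mono q r q⇒r xs)
... | true  | false | imp = ⊥-elim (imp tt)
... | false | true  | _   = m≤n⇒m≤1+n (countTrue-mono q r q⇒r xs)
... | false | false | _   = countTrue-mono q r q⇒r xs

countTrue-equal : {A : Set} (q r : A → Bool) → (∀ x → IsTrue (q x) → IsTrue (r x)) →
  (xs : List A) → countTrue r xs ≤ countTrue q xs → All (λ x → r x ≡ q x) xs
countTrue-equal q r q⇒r []       _  = []
countTrue-equal q r q⇒r (x ∷ xs) le with q x in qx | r x in rx | q⇒r x
... | true  | true  | _   = trans rx (sym qx) ∷ countTrue-equal q r q⇒r xs (≤-pred le)
... | true  | false | imp = ⊥-elim (imp tt)
... | false | true  | _   = ⊥-elim (<-irrefl refl (≤-trans le (countTrue-mono q r q⇒r xs)))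
... | false | false | _   = trans rx (sym qx) ∷ countTrue-equal q r q⇒r xs le

increasing-stabilises : {A : Set} (xs : List A) (p : ℕ → A → Bool) →
  (∀ i x → IsTrue (p i x) → IsTrue (p (suc i) x)) →
  ∃ λ i → All (λ x → p (suc i) x ≡ p i x) xs
increasing-stabilises xs p increasing = settle (growth (suc (length xs)))
  where
  Stationary : Set
  Stationary = ∃ λ i → All (λ x → p (suc i) x ≡ p i x) xs

  -- As long as no step is stationary, the count grows by at least one per step.
  growth : ∀ n → n ≤ countTrue (p n) xs ⊎ Stationary
  growth zero = inj₁ z≤n
  growth (suc n) with growth n
  ... | inj₂ stationary = inj₂ stationary
  ... | inj₁ n≤count with countTrue (p (suc n)) xs ≤? countTrue (p n) xs
  ...   | yes no-growth = inj₂ (n , countTrue-equal (p n) (p (suc n)) (increasing n) xs no-growth)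
  ...   | no  growth′   = inj₁ (≤-trans (s≤s n≤count) (≰⇒> growth′))

  settle : suc (length xs) ≤ countTrue (p (suc (length xs))) xs ⊎ Stationary → Stationary
  settle (inj₂ stationary) = stationary
  settle (inj₁ too-many)   =
    ⊥-elim (<-irrefl refl (≤-trans too-many (countTrue≤length (p (suc (length xs))) xs)))

allStates-complete : ∀ {m k} (s : State m k) → s ∈ allStates m k
allStates-complete (a , b , pl) = ∈-cartesianProduct⁺ (∈-allFin a) (∈-cartesianProduct⁺ (∈-allFin b) (player∈ pl))
  where
  player∈ : ∀ pl → pl ∈ allPlayers
  player∈ P₁ = here refl
  player∈ P₂ = there (here refl)

module Labelling {m k : ℕ} (G : GCR m k) where

  keep : ℕ∞ → ℕ∞ → ℕ∞
  keep (fin t) _         = fin t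
  keep ∞       candidate = candidate

  candidate : (State m k → ℕ∞) → State m k → ℕ∞
  candidate L s = suc∞ (optimum (playerOf G s) (map L (N G s)))

  relabel : (State m k → ℕ∞) → State m k → ℕ∞
  relabel L s = keep (L s) (candidate L s)

  T-step : ∀ i s → T G (suc i) s ≡ relabel (T G i) s
  T-step i (a , b , P₁) with T G i (a , b , P₁)
  ... | fin t = refl
  ... | ∞     = refl
  T-step i (a , b , P₂) with T G i (a , b , P₂)
  ... | fin t = refl
  ... | ∞     = refl

  relabel-cong : ∀ {L L′} → L ≗ L′ → relabel L ≗ relabel L′
  relabel-cong {L} {L′} L≗L′ s =
    cong₂ keep (L≗L′ s) (cong (suc∞ ∘ optimum (playerOf G s)) (map-cong L≗L′ (N G s)))

  T-keeps : ∀ i s {t} → T G i s ≡ fin t → T G (suc i) s ≡ fin t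
  T-keeps i s {t} eq = trans (T-step i s) (cong (λ x → keep x (candidate (T G i) s)) eq)

  T-extends : ∀ i s → T G i s ≡ ∞ →
    T G (suc i) s ≡ suc∞ (optimum (playerOf G s) (map (T G i) (N G s)))
  T-extends i s eq = trans (T-step i s) (cong (λ x → keep x (candidate (T G i) s)) eq)

  persist : ∀ {i j} s {t} → i ≤′ j → T G i s ≡ fin t → T G j s ≡ fin t
  persist             s ≤′-refl         eq = eq
  persist {j = suc j} s (≤′-step i≤′j) eq = T-keeps j s (persist s i≤′j eq)

  ∞-before : ∀ {i j} s → i ≤ j → T G j s ≡ ∞ → T G i s ≡ ∞
  ∞-before {i} s i≤j ∞-at-j with T G i s in eq
  ... | fin t = ⊥-elim (fin≢∞ (trans (sym (persist s (≤⇒≤′ i≤j) eq)) ∞-at-j))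
  ... | ∞     = refl

  labelled-after : ∀ u s → IsFin (optimum (playerOf G s) (map (T G u) (N G s))) →
    IsFin (T G (suc u) s)
  labelled-after u s (w , opt≡w) =
    let (t , eq) = keep-finite (T G u s) (suc w , cong suc∞ opt≡w) in t , trans (T-step u s) eq
    where
    keep-finite : ∀ x {y} → IsFin y → IsFin (keep x y)
    keep-finite (fin t) _        = t , refl
    keep-finite ∞       finite-y = finite-y

  EntryTime : State m k → ℕ → Set
  EntryTime s t = T G t s ≡ fin t × (∀ j → j < t → T G j s ≡ ∞)

  LabelsAreEntryTimes : ℕ → Set
  LabelsAreEntryTimes i = ∀ s t → T G i s ≡ fin t → t ≤ i × EntryTime s t

  new-label : ∀ i → LabelsAreEntryTimes i → ∀ s {u} → T G i s ≡ ∞ →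
    optimum (playerOf G s) (map (T G i) (N G s)) ≡ fin u → u ≡ i
  new-label i invariant s {u} unlabelled opt≡u with u <? i
  ... | no  u≮i = ≤-antisym u≤i (≮⇒≥ u≮i)
    where
    attaining : ∃ λ a → T G i a ≡ fin u
    attaining = Any.satisfied (AnyP.map⁻ (optimum-attained (playerOf G s) _ opt≡u))
    u≤i : u ≤ i
    u≤i = proj₁ (invariant (proj₁ attaining) u (proj₂ attaining))
  ... | yes u<i = ⊥-elim (fin≢∞ (trans (sym (persist s (≤⇒≤′ u<i) (proj₂ labelled-early))) unlabelled))
    where
    labelled-by-u : ∀ a → AtMost u (T G i a) → IsFin (T G u a)
    labelled-by-u a (v , eq , v≤u) = v , persist a (≤⇒≤′ v≤u) (proj₁ (proj₂ (invariant a v eq)))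
    labelled-early : IsFin (T G (suc u) s)
    labelled-early = labelled-after u s
      (optimum-transfer (playerOf G s) (N G s) (T G i) (T G u) opt≡u labelled-by-u)

  labels-are-entry-times : ∀ i → LabelsAreEntryTimes i
  labels-are-entry-times zero s t eq with GCR.capture G s in captured
  labels-are-entry-times zero s .0 refl | true =
    z≤n , cong (λ b → if b then fin 0 else ∞) captured , (λ j ())
  labels-are-entry-times (suc i) s = by-previous-label (T G i s) refl
    where
    by-previous-label : ∀ x → T G i s ≡ x → ∀ t → T G (suc i) s ≡ fin t → t ≤ suc i × EntryTime s t
    by-previous-label (fin t′) eq-i t eq with trans (sym (T-keeps i s eq-i)) eq
    ... | refl = let (t≤i , entry) = labels-are-entry-times i s t eq-i in m≤n⇒m≤1+n t≤i , entry
    by-previous-label ∞ eq-i t eq with suc∞-fin _ (trans (sym (T-extends i s eq-i)) eq)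
    ... | u , opt≡u , refl with new-label i (labels-are-entry-times i) s eq-i opt≡u
    ...   | refl = ≤-refl , eq , (λ j j<t → ∞-before s (≤-pred j<t) eq-i)

  no-new-labels : ∀ i s → isFin (T G (suc i) s) ≡ isFin (T G i s) → T G (suc i) s ≡ T G i s
  no-new-labels i s = by-previous-label (T G i s) refl (T G (suc i) s) refl
    where
    by-previous-label : ∀ x → T G i s ≡ x → ∀ y → T G (suc i) s ≡ y →
      isFin y ≡ isFin x → T G (suc i) s ≡ T G i s
    by-previous-label (fin t) eq-i _       _      _ = trans (T-keeps i s eq-i) (sym eq-i)
    by-previous-label ∞       eq-i ∞       eq-si _ = trans eq-si (sym eq-i)
    by-previous-label ∞       _    (fin _) _     ()

  labelled-stays : ∀ i s → IsTrue (isFin (T G i s)) → IsTrue (isFin (T G (suc i) s))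
  labelled-stays i s labelled = subst (IsTrue ∘ isFin) (sym (T-step i s)) (keep-labelled (T G i s) labelled)
    where
    keep-labelled : ∀ x {y} → IsTrue (isFin x) → IsTrue (isFin (keep x y))
    keep-labelled (fin t) _ = tt

  fixed-point : ∃ λ i₀ → ∀ j → i₀ ≤ j → T G j ≗ T G i₀
  fixed-point with increasing-stabilises (allStates m k) (λ i s → isFin (T G i s)) labelled-stays
  ... | i₀ , stationary = i₀ , λ j i₀≤j → stays (≤⇒≤′ i₀≤j)
    where
    one-round : T G (suc i₀) ≗ T G i₀
    one-round s = no-new-labels i₀ s (All.lookup stationary (allStates-complete s))

    stays : ∀ {j} → i₀ ≤′ j → T G j ≗ T G i₀
    stays ≤′-refl s = refl
    stays {suc j} (≤′-step i₀≤′j) s = begin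
      T G (suc j) s        ≡⟨ T-step j s ⟩
      relabel (T G j) s    ≡⟨ relabel-cong (stays i₀≤′j) s ⟩
      relabel (T G i₀) s   ≡⟨ sym (T-step i₀ s) ⟩
      T G (suc i₀) s       ≡⟨ one-round s ⟩
      T G i₀ s             ∎
      where open ≡-Reasoning

proposition3p3 : (m k : ℕ) (G : GCR m k) (s : State m k) →
    ∃ λ v → IsLimit G s v × IsFirstFinite G s v
proposition3p3 m k G s = limit-at (proj₂ fixed-point) (T G i₀ s) refl
  where
  open Labelling G
  i₀ : ℕ
  i₀ = proj₁ fixed-point

  limit-at : (∀ j → i₀ ≤ j → T G j ≗ T G i₀) → ∀ v → T G i₀ s ≡ v →
    ∃ λ v → IsLimit G s v × IsFirstFinite G s v
  limit-at fixed (fin t) eq with labels-are-entry-times i₀ s t eq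
  ... | _ , labelled-at-t , unlabelled-before =
    fin t , (t , λ j t≤j → persist s (≤⇒≤′ t≤j) labelled-at-t) , (t , labelled-at-t) , unlabelled-before
  limit-at fixed ∞ eq = ∞ , (i₀ , λ j i₀≤j → trans (fixed j i₀≤j s) eq) , never-labelled
    where
    never-labelled : ∀ j → T G j s ≡ ∞
    never-labelled j with ≤-total j i₀
    ... | inj₁ j≤i₀ = ∞-before s j≤i₀ eq
    ... | inj₂ i₀≤j = trans (fixed j i₀≤j s) eq
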